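{- Let $n\ge1$, and let $f,g_1,\dots,g_n$ be monotone functions on binary relations over a set $X$ with $f$ extensive and $g_1\supseteq g_2\supseteq\dots\supseteq g_n$. Suppose $f$ is $g_1$-compatible and, for some integers $m_i\ge1$, $f$ is $g_i^{m_i},g_{i+1}$-compatible for each $1\le i<n$. Then $f$ is $g_n$-sound via $f^\omega$: for every relation $\mathcal R$, $\mathcal R\subseteq g_n(f(\mathcal R))$ implies $f^\omega(\mathcal R)\subseteq g_n(f^\omega(\mathcal R))$.
   Context: Fix a set $X$. A function on relations is a map from the set of binary relations on $X$ to itself. For such functions, $(f\circ g)(\mathcal R)=f(g(\mathcal R))$, intersections and unions are pointwise, and $f\subseteq g$ means $f(\mathcal R)\subseteq g(\mathcal R)$ for all $\mathcal R$. $f^0=\mathrm{id}$, $f^{k+1}=f\circ f^k$, $f^\omega(\mathcal R)=\bigcup_{k\in\mathbb N}f^k(\mathcal R)$. $f$ is monotone if $\mathcal R\subseteq\mathcal S$ implies $f(\mathcal R)\subseteq f(\mathcal S)$; extensive (expansive) if $\mathrm{id}\subseteq f$. $f$ is $g$-compatible if $f\circ g\subseteq g\circ f$; $f$ is $g,h$-compatible if $f\circ(g\cap h)\subseteq h\circ f$. $f$ is $g$-sound via $f'$ if $f'$ is extensive and for every $\mathcal R$, $\mathcal R\subseteq g(f(\mathcal R))$ implies $f'(\mathcal R)\subseteq g(f'(\mathcal R))$. -}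

module Defs where

open import Level using (Level; _⊔_)
open import Data.Nat using (ℕ; zero; suc)
open import Data.Product using (Σ; _×_; _,_)
open import Relation.Binary.Core using (Rel)

private variable
  a ℓ : Level

RelFun : (X : Set a) (ℓ : Level) → Set _
RelFun {a} X ℓ = Rel X ℓ → Rel X ℓ

_⊆ᴿ_ : {X : Set a} → Rel X ℓ → Rel X ℓ → Set _
R ⊆ᴿ S = ∀ {x y} → R x y → S x y

_∩ᴿ_ : {X : Set a} → Rel X ℓ → Rel X ℓ → Rel X ℓ
(R ∩ᴿ S) x y = R x y × S x y

_⊆ᶠ_ : {X : Set a} → RelFun X ℓ → RelFun X ℓ → Set _
f ⊆ᶠ g = ∀ R → f R ⊆ᴿ g R

_∘ᶠ_ : {X : Set a} → RelFun X ℓ → RelFun X ℓ → RelFun X ℓ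
(f ∘ᶠ g) R = f (g R)

_∩ᶠ_ : {X : Set a} → RelFun X ℓ → RelFun X ℓ → RelFun X ℓ
(f ∩ᶠ g) R = f R ∩ᴿ g R

idᶠ : {X : Set a} → RelFun X ℓ
idᶠ R = R

_^ᶠ_ : {X : Set a} → RelFun X ℓ → ℕ → RelFun X ℓ
(f ^ᶠ zero) = idᶠ
(f ^ᶠ suc k) = f ∘ᶠ (f ^ᶠ k)

_^ω : {X : Set a} → RelFun X ℓ → RelFun X ℓ
(f ^ω) R x y = Σ ℕ λ k → (f ^ᶠ k) R x y

Monotone : {X : Set a} → RelFun X ℓ → Set _
Monotone f = ∀ {R S} → R ⊆ᴿ S → f R ⊆ᴿ f S

Extensive : {X : Set a} → RelFun X ℓ → Set _
Extensive f = idᶠ ⊆ᶠ f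

Compatible : {X : Set a} → RelFun X ℓ → RelFun X ℓ → Set _
Compatible f g = (f ∘ᶠ g) ⊆ᶠ (g ∘ᶠ f)

Compatible₂ : {X : Set a} → RelFun X ℓ → RelFun X ℓ → RelFun X ℓ → Set _
Compatible₂ f g h = (f ∘ᶠ (g ∩ᶠ h)) ⊆ᶠ (h ∘ᶠ f)

SoundVia : {X : Set a} → RelFun X ℓ → RelFun X ℓ → RelFun X ℓ → Set _
SoundVia f g f' = Extensive f' × (∀ R → R ⊆ᴿ g (f R) → f' R ⊆ᴿ g (f' R))

{-# OPTIONS --safe #-}
-- Fix R with R ⊆ gₙ(f R) and say that h covers the k-th iterate when
-- fᵏ R ⊆ h(fʲ R) for all sufficiently large j.  Functions covering every
-- iterate are closed under composition, and if R ⊆ h(f R) and f ∘ h₀ ⊆ h ∘ f,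
-- then induction on k shows that h covers every iterate as soon as h₀ covers
-- each iterate that h does.  Climbing the chain, g₁ covers by compatibility
-- and gᵢ₊₁ by taking h₀ = gᵢ^mᵢ ∩ gᵢ₊₁; finally, covering by gₙ says exactly
-- that f^ω R ⊆ gₙ(f^ω R).
module Submission where

open import Defs
open import Level using (Level)
open import Relation.Binary.Core using (Rel)
open import Data.Nat using (ℕ; zero; suc; _≤_; _<_; _≤′_; ≤′-refl; ≤′-step; s≤s; z≤n; _⊔_)
open import Data.Nat.Properties using (≤⇒≤′; ≤′⇒≤; m≤m⊔n; m≤n⊔m; ≤-trans; n≤1+n; ≤-refl)
open import Data.Product using (Σ; _,_)

module Covering {a ℓ : Level} {X : Set a} {f : RelFun X ℓ}
                (f-mono : Monotone f) (f-ext : Extensive f) (R : Rel X ℓ) where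

  iterate-mono′ : ∀ {k j} → k ≤′ j → (f ^ᶠ k) R ⊆ᴿ (f ^ᶠ j) R
  iterate-mono′ ≤′-refl           = λ p → p
  iterate-mono′ (≤′-step {j} k≤j) = λ p → f-ext ((f ^ᶠ j) R) (iterate-mono′ k≤j p)

  iterate-mono : ∀ {k j} → k ≤ j → (f ^ᶠ k) R ⊆ᴿ (f ^ᶠ j) R
  iterate-mono k≤j = iterate-mono′ (≤⇒≤′ k≤j)

  Covers : RelFun X ℓ → ℕ → Set _
  Covers h k = Σ ℕ λ N → ∀ j → N ≤ j → (f ^ᶠ k) R ⊆ᴿ h ((f ^ᶠ j) R)

  Covering : RelFun X ℓ → Set _
  Covering h = ∀ k → Covers h k

  covering-id : Covering idᶠ
  covering-id k = k , λ j k≤j → iterate-mono k≤j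

  covering-∘ : ∀ {h h′} → Monotone h → Covering h → Covering h′ → Covering (h ∘ᶠ h′)
  covering-∘ h-mono cov cov′ k with cov k
  ... | N , covₖ with cov′ N
  ... | N′ , cov′ₙ = N′ , λ j N′≤j p → h-mono (cov′ₙ j N′≤j) (covₖ N ≤-refl p)

  covering-^ : ∀ {h} → Monotone h → Covering h → ∀ m → Covering (h ^ᶠ m)
  covering-^ h-mono cov zero    = covering-id
  covering-^ {h} h-mono cov (suc m) = covering-∘ {h} {h ^ᶠ m} h-mono cov (covering-^ h-mono cov m)

  covers-∩ : ∀ {h h′ k} → Covers h k → Covers h′ k → Covers (h ∩ᶠ h′) k
  covers-∩ (N , cov) (N′ , cov′) = N ⊔ N′ , λ j N⊔N′≤j p →
    cov  j (≤-trans (m≤m⊔n N N′) N⊔N′≤j) p ,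
    cov′ j (≤-trans (m≤n⊔m N N′) N⊔N′≤j) p

  covering-by-induction : ∀ {h} (h₀ : RelFun X ℓ) → Monotone h → R ⊆ᴿ h (f R) →
    (∀ k → Covers h k → Covers h₀ k) → (f ∘ᶠ h₀) ⊆ᶠ (h ∘ᶠ f) → Covering h
  covering-by-induction h₀ h-mono R⊆hfR transfer comp zero =
    1 , λ j 1≤j p → h-mono (iterate-mono 1≤j) (R⊆hfR p)
  covering-by-induction h₀ h-mono R⊆hfR transfer comp (suc k)
    with transfer k (covering-by-induction h₀ h-mono R⊆hfR transfer comp k)
  ... | N , cov₀ = suc N , λ j N<j p →
    h-mono (iterate-mono N<j) (comp ((f ^ᶠ N) R) (f-mono (cov₀ N ≤-refl) p))

  covering-compatible : ∀ {h} → Monotone h → R ⊆ᴿ h (f R) → Compatible f h → Covering h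
  covering-compatible {h} h-mono R⊆hfR = covering-by-induction h h-mono R⊆hfR (λ k c → c)

  covering-compatible₂ : ∀ {h h′} → Monotone h → R ⊆ᴿ h (f R) →
    Covering h′ → Compatible₂ f h′ h → Covering h
  covering-compatible₂ {h} {h′} h-mono R⊆hfR cov′ =
    covering-by-induction (h′ ∩ᶠ h) h-mono R⊆hfR (λ k → covers-∩ {h′} {h} {k} (cov′ k))

  covering⇒ω-⊆ : ∀ {h} → Monotone h → Covering h → (f ^ω) R ⊆ᴿ h ((f ^ω) R)
  covering⇒ω-⊆ h-mono cov (k , p) with cov k
  ... | N , covₖ = h-mono (λ q → N , q) (covₖ N ≤-refl p)

module _ {a ℓ : Level} {X : Set a} {n : ℕ} (g : ℕ → RelFun X ℓ)
         (g-step : ∀ i → 1 ≤ i → i < n → g (suc i) ⊆ᶠ g i) where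

  chain-antitone′ : ∀ {i j} → 1 ≤ i → i ≤′ j → j ≤ n → g j ⊆ᶠ g i
  chain-antitone′ 1≤i ≤′-refl           j≤n S p = p
  chain-antitone′ 1≤i (≤′-step {j} i≤j) j<n S p =
    chain-antitone′ 1≤i i≤j (≤-trans (n≤1+n j) j<n) S
      (g-step j (≤-trans 1≤i (≤′⇒≤ i≤j)) j<n S p)

  chain-antitone : ∀ {i j} → 1 ≤ i → i ≤ j → j ≤ n → g j ⊆ᶠ g i
  chain-antitone 1≤i i≤j = chain-antitone′ 1≤i (≤⇒≤′ i≤j)

theorem42 : {a ℓ : Level} {X : Set a} (n : ℕ) → 1 ≤ n →
    (f : RelFun X ℓ) (g : ℕ → RelFun X ℓ) →
    Monotone f → Extensive f →
    (∀ i → 1 ≤ i → i ≤ n → Monotone (g i)) →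
    (∀ i → 1 ≤ i → i < n → g (suc i) ⊆ᶠ g i) →
    Compatible f (g 1) →
    (m : ℕ → ℕ) → (∀ i → 1 ≤ i → i < n → 1 ≤ m i) →
    (∀ i → 1 ≤ i → i < n → Compatible₂ f (g i ^ᶠ m i) (g (suc i))) →
    SoundVia f (g n) (f ^ω)
theorem42 n 1≤n f g f-mono f-ext g-mono g-step comp₁ m _ comp₂ =
  (λ R p → 0 , p) , sound
  where
  sound : ∀ R → R ⊆ᴿ g n (f R) → (f ^ω) R ⊆ᴿ g n ((f ^ω) R)
  sound R R⊆gₙfR = covering⇒ω-⊆ (g-mono n 1≤n ≤-refl) (level n 1≤n ≤-refl)
    where
    open Covering f-mono f-ext R

    R⊆gfR : ∀ i → 1 ≤ i → i ≤ n → R ⊆ᴿ g i (f R)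
    R⊆gfR i 1≤i i≤n = λ p → chain-antitone g g-step 1≤i i≤n ≤-refl (f R) (R⊆gₙfR p)

    level : ∀ i → 1 ≤ i → i ≤ n → Covering (g i)
    level 1 _ 1≤n′ = covering-compatible (g-mono 1 ≤-refl 1≤n′) (R⊆gfR 1 ≤-refl 1≤n′) comp₁
    level (suc (suc t)) 1≤i i≤n =
      covering-compatible₂ (g-mono (suc (suc t)) 1≤i i≤n) (R⊆gfR (suc (suc t)) 1≤i i≤n)
        (covering-^ (g-mono (suc t) (s≤s z≤n) i-1≤n) (level (suc t) (s≤s z≤n) i-1≤n) (m (suc t)))
        (comp₂ (suc t) (s≤s z≤n) i≤n)
      where i-1≤n = ≤-trans (n≤1+n (suc t)) i≤n
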